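{- Let $X=\{a_1,\dots,a_{3n}\}$ be a set of distinct natural numbers with $\sum_i a_i=nB$ and $B/4<a_i<B/2$ for all $i$, and let $m$, $T_1,\dots,T_{m+1}$ and $IG(X)$ be as defined in the context. If $(y_1,\dots,y_{2m+1})$ is a burning sequence of $IG(X)$ of length $2m+1$ (i.e., an optimal burning sequence), then for every $1\le i\le m+1$, $y_i=r_i$, where $r_i$ is the $(2m-i+2)$-th vertex of the path $T_i$ (its middle vertex).
   Context: Let $m=\max(X)$, $X'=\{2a_i-1: a_i\in X\}$, $B'=2B-3$, $F'_m=\{1,3,\dots,2m-1\}$, $Y=F'_m\setminus X'$, $k=|Y|=m-3n$. Take paths $Q_1,\dots,Q_n$ each with $B'$ vertices; paths $Q'_1,\dots,Q'_k$ where $Q'_j$ has as many vertices as the $j$-th largest element of $Y$; and paths $T_1,\dots,T_{m+1}$ where $T_j$ has $2(2m+1-j)+1$ vertices. Join them (adding an edge from the last vertex of one to the first vertex of the next) in the order $Q_1,T_1,\dots,Q_n,T_n,Q'_1,T_{n+1},\dots,Q'_k,T_{n+k},T_{n+k+1},\dots,T_{m+1}$ to obtain a path $P_I$ with $(2m+1)^2$ vertices. Then attach to every vertex of each $T_j$ other than its first and last vertex a new pendant vertex. The resulting graph is $IG(X)$. Graph burning on $G$: in each round $t$, first a vertex $x_t$ is chosen as a fire source and becomes burnt, then every vertex adjacent to a vertex burnt by the end of round $t-1$ becomes burnt. A burning sequence $(x_1,\dots,x_k)$ is one with $\bigcup_{i=1}^k N_{k-i}[x_i]=V(G)$, $N_r[x]$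 being the set of vertices at distance at most $r$ from $x$. -}

module Defs where

open import Data.Nat using (ℕ; zero; suc; _+_; _*_; _∸_; _⊔_; _<_; _≤_; _≟_)
open import Data.List using (List; []; _∷_; _++_; foldr; map; concat; replicate;
  applyUpTo; applyDownFrom; filter; zipWith; upTo; length)
open import Data.List.Membership.Propositional using (_∈_)
open import Data.List.Membership.DecPropositional _≟_ using (_∈?_)
open import Data.Product using (Σ; _×_; ∃; ∃-syntax)
open import Data.Fin using (Fin; toℕ)
open import Data.Empty using (⊥)
open import Relation.Nullary using (¬?)
open import Relation.Binary.PropositionalEquality using (_≡_)

record Graph (V : Set) : Set₁ where
  field
    vert : V → Set
    adj  : V → V → Set

data Within {V : Set} (G : Graph V) : ℕ → V → V → Set where
  here : ∀ {r x} → Within G r x x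
  step : ∀ {r x y z} → Graph.adj G x y → Within G r y z → Within G (suc r) x z

-- (y_1,…,y_k) (here indexed by Fin k, y (i) = y_{toℕ i + 1}) is a burning
-- sequence: every vertex lies in ⋃_i N_{k-i}[y_i].
IsBurningSeq : {V : Set} (G : Graph V) (k : ℕ) (y : Fin k → V) → Set
IsBurningSeq G k y =
  ((i : Fin k) → Graph.vert G (y i)) ×
  (∀ v → Graph.vert G v → ∃[ i ] Within G (k ∸ suc (toℕ i)) (y i) v)

-- Path vertices are labelled by component and offset (0-based):
--   qv c t : t-th vertex of the c-th Q-type path (Q_1..Q_n, Q'_1..Q'_k, c 0-based)
--   tv j t : t-th vertex of T_j  (j 1-based as in the paper)
data Lab : Set where
  qv : ℕ → ℕ → Lab
  tv : ℕ → ℕ → Lab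

-- Vertices of IG(X): path vertices and pendant vertices (pd a hangs at pv a).
data Vtx : Set where
  pv : Lab → Vtx
  pd : Lab → Vtx

maxL : List ℕ → ℕ
maxL = foldr _⊔_ 0

oddsDesc : ℕ → List ℕ
oddsDesc m = applyDownFrom (λ j → 2 * j + 1) m

X′ : List ℕ → List ℕ
X′ X = map (λ a → 2 * a ∸ 1) X

-- Y = F'_m \ X', in decreasing order (j-th entry = j-th largest element)
Ylist : List ℕ → List ℕ
Ylist X = filter (λ y → ¬? (y ∈? X′ X)) (oddsDesc (maxL X))

lenT : ℕ → ℕ → ℕ
lenT m j = 2 * (2 * m + 1 ∸ j) + 1

-- lengths of Q_1..Q_n (B' = 2B-3 each) followed by Q'_1..Q'_k
Qlens : ℕ → ℕ → List ℕ → List ℕ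
Qlens n B X = replicate n (2 * B ∸ 3) ++ Ylist X

Qblocks : ℕ → ℕ → List ℕ → List (List Lab)
Qblocks n B X = zipWith (λ c ℓ → applyUpTo (qv c) ℓ) (upTo (length (Qlens n B X))) (Qlens n B X)

Tblocks : ℕ → List (List Lab)
Tblocks m = applyUpTo (λ i → applyUpTo (tv (suc i)) (lenT m (suc i))) (suc m)

interleave : {A : Set} → List A → List A → List A
interleave (q ∷ qs) (t ∷ ts) = q ∷ t ∷ interleave qs ts
interleave []       ts       = ts
interleave qs       []       = qs

-- The path P_I: Q_1,T_1,…,Q_n,T_n,Q'_1,T_{n+1},…,Q'_k,T_{n+k},T_{n+k+1},…,T_{m+1}
PI : ℕ → ℕ → List ℕ → List Lab
PI n B X = concat (interleave (Qblocks n B X) (Tblocks (maxL X)))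

Consec : List Lab → Lab → Lab → Set
Consec P a b = ∃[ xs ] ∃[ ys ] (P ≡ xs ++ a ∷ b ∷ ys)

InternalT : ℕ → Lab → Set
InternalT m (qv _ _) = ⊥
InternalT m (tv j t) = (0 < t) × (suc t < lenT m j)

IGvert : ℕ → ℕ → List ℕ → Vtx → Set
IGvert n B X (pv a) = a ∈ PI n B X
IGvert n B X (pd a) = (a ∈ PI n B X) × InternalT (maxL X) a

data IGadj (n B : ℕ) (X : List ℕ) : Vtx → Vtx → Set where
  path→  : ∀ {a b} → Consec (PI n B X) a b → IGadj n B X (pv a) (pv b)
  path←  : ∀ {a b} → Consec (PI n B X) a b → IGadj n B X (pv b) (pv a)
  pend→  : ∀ {a} → a ∈ PI n B X → InternalT (maxL X) a → IGadj n B X (pv a) (pd a)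
  pend←  : ∀ {a} → a ∈ PI n B X → InternalT (maxL X) a → IGadj n B X (pd a) (pv a)

IG : ℕ → ℕ → List ℕ → Graph Vtx
IG n B X = record { vert = IGvert n B X ; adj = IGadj n B X }

module Submission where

-- Let m = max X, K = 2m + 1, and let y_0, …, y_{2m} be a burning
-- sequence of IG(X), so y_i burns for r_i = 2m − i rounds.  Project everything
-- onto the spine P_I: a source burns path vertices only inside an interval of
-- width at most 2r_i + 1 around its position, and only 2r_i − 1 if it is a
-- pendant vertex.  These widths add up to (2m+1)² ≤ |P_I| (balls-fit), while
-- the intervals must cover all of P_I.  A double counting argument (tight-cover)
-- then shows that all sources lie on the spine and that their balls are
-- pairwise disjoint along it.  Finally, for i = 0, …, m in turn, the pendants of
-- T_{i+1} force one source to sweep the whole block T_{i+1} (of length 2r_i + 1);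
-- its radius is at least r_i, earlier sources are already the middles of their
-- own blocks, so it is y_i itself, sitting exactly at the middle of T_{i+1}.

open import Defs
open import Data.Nat using (ℕ; zero; suc; _+_; _*_; _∸_; _<_; _≤_; _⊓_; z≤n; s≤s; s≤s⁻¹; _≤?_; _<?_; _≟_)
open import Data.Nat.Properties
open import Data.Nat.ListAction using (sum)
import Data.Nat.ListAction.Properties as Sumₚ
open import Data.Nat.Tactic.RingSolver using (solve-∀)
open import Data.Fin using (Fin; toℕ; fromℕ<) renaming (zero to fzero; suc to fsuc)
import Data.Fin.Properties as Finₚ
open import Data.Fin.Induction using (<-wellFounded)
open import Data.List using (List; []; _∷_; _++_; length; applyUpTo; applyDownFrom; map; zipWith; concat; upTo; filter; replicate)
import Data.List.Properties as Listₚ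
open import Data.List.Membership.Propositional using (_∈_)
import Data.List.Membership.Propositional.Properties as ∈ₚ
open import Data.List.Membership.DecPropositional _≟_ using (_∈?_)
open import Data.List.Relation.Unary.Any using (here; there)
open import Data.List.Relation.Unary.All using (All; []; _∷_)
import Data.List.Relation.Unary.All as All
import Data.List.Relation.Unary.All.Properties as Allₚ
open import Data.List.Relation.Unary.AllPairs using (AllPairs; []; _∷_)
import Data.List.Relation.Unary.AllPairs.Properties as AllPairsₚ
open import Data.List.Relation.Unary.Unique.Propositional using (Unique)
import Data.List.Relation.Unary.Unique.Propositional.Properties as Uniqueₚ
open import Data.List.Relation.Binary.Disjoint.Propositional using (Disjoint)
import Data.List.Relation.Binary.Disjoint.Propositional.Properties as Disjointₚ
open import Data.Maybe using (Maybe; just; nothing)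
open import Data.Maybe.Properties using (just-injective)
open import Data.Product using (_×_; _,_; proj₁; proj₂; ∃-syntax)
open import Data.Sum using (_⊎_; inj₁; inj₂)
open import Data.Unit using (⊤; tt)
open import Data.Empty using (⊥; ⊥-elim)
open import Function using (_∘_)
open import Level using (0ℓ)
open import Relation.Nullary using (¬_; Dec; yes; no; ¬?; _×-dec_)
open import Relation.Unary using (Decidable)
open import Relation.Binary.PropositionalEquality
  using (_≡_; _≢_; refl; sym; trans; cong; cong₂; subst; module ≡-Reasoning)
open import Algebra.Properties.CommutativeMonoid.Sum +-0-commutativeMonoid
  using (sum-syntax; ∑-comm; sum-init-last; sum-cong-≗)
import Induction.WellFounded as WF

𝟙 : {A : Set} → Dec A → ℕ
𝟙 (yes _) = 1
𝟙 (no _)  = 0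

𝟙-yes : {A : Set} (d : Dec A) → A → 𝟙 d ≡ 1
𝟙-yes (yes _) _ = refl
𝟙-yes (no ¬a) a = ⊥-elim (¬a a)

∑-mono : ∀ {K} (f g : Fin K → ℕ) → (∀ i → f i ≤ g i) → ∑[ i < K ] f i ≤ ∑[ i < K ] g i
∑-mono {zero}  f g f≤g = z≤n
∑-mono {suc K} f g f≤g = +-mono-≤ (f≤g fzero) (∑-mono (f ∘ fsuc) (g ∘ fsuc) (f≤g ∘ fsuc))

∑-tight : ∀ {K} (f g : Fin K → ℕ) → (∀ i → f i ≤ g i) → ∑[ i < K ] g i ≤ ∑[ i < K ] f i →
  ∀ i → g i ≤ f i
∑-tight {suc K} f g f≤g ∑g≤∑f fzero = +-cancelʳ-≤ _ _ _
  (≤-trans ∑g≤∑f (+-monoʳ-≤ (f fzero) (∑-mono (f ∘ fsuc) (g ∘ fsuc) (f≤g ∘ fsuc))))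
∑-tight {suc K} f g f≤g ∑g≤∑f (fsuc i) = ∑-tight (f ∘ fsuc) (g ∘ fsuc) (f≤g ∘ fsuc)
  (+-cancelˡ-≤ (g fzero) _ _ (≤-trans ∑g≤∑f (+-monoˡ-≤ _ (f≤g fzero)))) i

term≤∑ : ∀ {K} (f : Fin K → ℕ) i → f i ≤ ∑[ k < K ] f k
term≤∑ f fzero    = m≤m+n _ _
term≤∑ f (fsuc i) = ≤-trans (term≤∑ (f ∘ fsuc) i) (m≤n+m _ _)

pair≤∑ : ∀ {K} (f : Fin K → ℕ) {i j} → i ≢ j → f i + f j ≤ ∑[ k < K ] f k
pair≤∑ f {fzero}  {fzero}  i≢j = ⊥-elim (i≢j refl)
pair≤∑ f {fzero}  {fsuc j} _   = +-monoʳ-≤ (f fzero) (term≤∑ (f ∘ fsuc) j)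
pair≤∑ f {fsuc i} {fzero}  i≢j = ≤-trans (≤-reflexive (+-comm (f (fsuc i)) _)) (pair≤∑ f (i≢j ∘ sym))
pair≤∑ f {fsuc i} {fsuc j} i≢j =
  ≤-trans (pair≤∑ (f ∘ fsuc) (i≢j ∘ cong fsuc)) (m≤n+m _ _)

∑-ones : ∀ N → ∑[ p < N ] 1 ≡ N
∑-ones zero    = refl
∑-ones (suc N) = cong suc (∑-ones N)

∑-snoc : ∀ N (g : ℕ → ℕ) → ∑[ p < suc N ] g (toℕ p) ≡ ∑[ p < N ] g (toℕ p) + g N
∑-snoc N g = trans (sum-init-last {N} (g ∘ toℕ))
  (cong₂ _+_ (sum-cong-≗ {N} (cong g ∘ Finₚ.toℕ-inject₁)) (cong g (Finₚ.toℕ-fromℕ N)))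

_∈[_,_⟩ : ℕ → ℕ → ℕ → Set
p ∈[ lo , hi ⟩ = lo ≤ p × p < hi

_∈?[_,_⟩ : ∀ p lo hi → Dec (p ∈[ lo , hi ⟩)
p ∈?[ lo , hi ⟩ = (lo ≤? p) ×-dec (p <? hi)

count-interval : ∀ N lo hi → ∑[ p < N ] 𝟙 (toℕ p ∈?[ lo , hi ⟩) ≤ hi ∸ lo
count-interval N lo hi = ≤-trans (count N) (∸-monoˡ-≤ lo (m⊓n≤n N hi))
  where
  χ : ℕ → ℕ
  χ p = 𝟙 (p ∈?[ lo , hi ⟩)
  count : ∀ N → ∑[ p < N ] χ (toℕ p) ≤ (N ⊓ hi) ∸ lo
  count zero    = z≤n
  count (suc N) rewrite ∑-snoc N χ with N ∈?[ lo , hi ⟩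
  ... | yes (lo≤N , N<hi) = begin
    ∑[ p < N ] χ (toℕ p) + 1 ≤⟨ +-monoˡ-≤ 1 (count N) ⟩
    (N ⊓ hi) ∸ lo + 1        ≡⟨ cong (λ k → k ∸ lo + 1) (m≤n⇒m⊓n≡m (<⇒≤ N<hi)) ⟩
    N ∸ lo + 1               ≡⟨ +-comm (N ∸ lo) 1 ⟩
    suc (N ∸ lo)             ≡⟨ +-∸-assoc 1 lo≤N ⟨
    suc N ∸ lo               ≡⟨ cong (_∸ lo) (m≤n⇒m⊓n≡m N<hi) ⟨
    (suc N ⊓ hi) ∸ lo        ∎
    where open ≤-Reasoning
  ... | no _ = ≤-trans (≤-reflexive (+-identityʳ _))
                 (≤-trans (count N) (∸-monoˡ-≤ lo (⊓-monoˡ-≤ hi (n≤1+n N))))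

-- Let K intervals [lo i, hi i) of widths at most len i cover
-- the points 0 … N-1, where ∑ len i ≤ N.  Then double counting the incidences
-- (point, interval) forces equality everywhere: every interval has width at least
-- len i, and no point below N lies in two of them.
tight-cover : ∀ {K} N (lo hi len : Fin K → ℕ) →
  (∀ i → hi i ∸ lo i ≤ len i) → ∑[ i < K ] len i ≤ N →
  (∀ p → p < N → ∃[ i ] p ∈[ lo i , hi i ⟩) →
  (∀ i → len i ≤ hi i ∸ lo i) ×
  (∀ p → p < N → ∀ {i j} → p ∈[ lo i , hi i ⟩ → p ∈[ lo j , hi j ⟩ → i ≡ j)
tight-cover {K} N lo hi len width≤ ∑len≤N cover = width≥ , exclusive
  where
  inc : Fin K → Fin N → ℕ
  inc i p = 𝟙 (toℕ p ∈?[ lo i , hi i ⟩)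
  hits : Fin K → ℕ
  hits i = ∑[ p < N ] inc i p
  depth : Fin N → ℕ
  depth p = ∑[ i < K ] inc i p
  hits≤len : ∀ i → hits i ≤ len i
  hits≤len i = ≤-trans (count-interval N (lo i) (hi i)) (width≤ i)
  depth≥1 : ∀ p → 1 ≤ depth p
  depth≥1 p with cover (toℕ p) (Finₚ.toℕ<n p)
  ... | i , p∈i = ≤-trans (≤-reflexive (sym (𝟙-yes (toℕ p ∈?[ lo i , hi i ⟩) p∈i)))
                    (term≤∑ (λ k → inc k p) i)
  -- the incidence count, summed either way, is squeezed between N and ∑ len
  ∑depth≤N : ∑[ p < N ] depth p ≤ ∑[ p < N ] 1
  ∑depth≤N = begin
    ∑[ p < N ] depth p ≡⟨ ∑-comm inc ⟨
    ∑[ i < K ] hits i  ≤⟨ ∑-mono hits len hits≤len ⟩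
    ∑[ i < K ] len i   ≤⟨ ∑len≤N ⟩
    N                  ≡⟨ ∑-ones N ⟨
    ∑[ p < N ] 1       ∎
    where open ≤-Reasoning
  ∑len≤∑hits : ∑[ i < K ] len i ≤ ∑[ i < K ] hits i
  ∑len≤∑hits = begin
    ∑[ i < K ] len i   ≤⟨ ∑len≤N ⟩
    N                  ≡⟨ ∑-ones N ⟨
    ∑[ p < N ] 1       ≤⟨ ∑-mono (λ _ → 1) depth depth≥1 ⟩
    ∑[ p < N ] depth p ≡⟨ ∑-comm inc ⟨
    ∑[ i < K ] hits i  ∎
    where open ≤-Reasoning
  width≥ : ∀ i → len i ≤ hi i ∸ lo i
  width≥ i = ≤-trans (∑-tight hits len hits≤len ∑len≤∑hits i) (count-interval N (lo i) (hi i))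
  exclusive : ∀ p → p < N → ∀ {i j} → p ∈[ lo i , hi i ⟩ → p ∈[ lo j , hi j ⟩ → i ≡ j
  exclusive p p<N {i} {j} p∈i p∈j with i Finₚ.≟ j
  ... | yes i≡j = i≡j
  ... | no i≢j = ⊥-elim (1+n≰n (begin
    2                     ≡⟨ cong₂ _+_ (counted p∈i) (counted p∈j) ⟨
    inc i q + inc j q     ≤⟨ pair≤∑ (λ k → inc k q) i≢j ⟩
    depth q               ≤⟨ ∑-tight (λ _ → 1) depth depth≥1 ∑depth≤N q ⟩
    1                     ∎))
    where
    open ≤-Reasoning
    q : Fin N
    q = fromℕ< p<N
    counted : ∀ {k} → p ∈[ lo k , hi k ⟩ → inc k q ≡ 1
    counted {k} p∈k = 𝟙-yes (toℕ q ∈?[ lo k , hi k ⟩)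
      (subst (_∈[ lo k , hi k ⟩) (sym (Finₚ.toℕ-fromℕ< p<N)) p∈k)

nth : {A : Set} → List A → ℕ → Maybe A
nth []       _       = nothing
nth (x ∷ xs) zero    = just x
nth (x ∷ xs) (suc p) = nth xs p

_[_]≡_ : {A : Set} → List A → ℕ → A → Set
xs [ p ]≡ a = nth xs p ≡ just a

module _ {A : Set} where

  nth-++ʳ : ∀ (xs ys : List A) p → nth (xs ++ ys) (length xs + p) ≡ nth ys p
  nth-++ʳ []       ys p = refl
  nth-++ʳ (x ∷ xs) ys p = nth-++ʳ xs ys p

  nth-++ˡ : ∀ (xs ys : List A) {p} → p < length xs → nth (xs ++ ys) p ≡ nth xs p
  nth-++ˡ (x ∷ xs) ys {zero}  _         = refl
  nth-++ˡ (x ∷ xs) ys {suc p} (s≤s p<n) = nth-++ˡ xs ys p<n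

  entry-∈ : ∀ {xs : List A} {p a} → xs [ p ]≡ a → a ∈ xs
  entry-∈ {x ∷ xs} {zero}  refl = here refl
  entry-∈ {x ∷ xs} {suc p} xs[p] = there (entry-∈ {xs} xs[p])

  ∈-entry : ∀ {xs : List A} {a} → a ∈ xs → ∃[ p ] xs [ p ]≡ a
  ∈-entry (here refl) = zero , refl
  ∈-entry (there a∈xs) with ∈-entry a∈xs
  ... | p , xs[p] = suc p , xs[p]

  entry-< : ∀ {xs : List A} {p a} → xs [ p ]≡ a → p < length xs
  entry-< {x ∷ xs} {zero}  _     = s≤s z≤n
  entry-< {x ∷ xs} {suc p} xs[p] = s≤s (entry-< {xs} xs[p])

  <-entry : ∀ (xs : List A) {p} → p < length xs → ∃[ a ] xs [ p ]≡ a
  <-entry (x ∷ xs) {zero}  _         = x , refl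
  <-entry (x ∷ xs) {suc p} (s≤s p<n) = <-entry xs p<n

  entry-functional : ∀ {xs : List A} {p a b} → xs [ p ]≡ a → xs [ p ]≡ b → a ≡ b
  entry-functional xs[p]≡a xs[p]≡b = just-injective (trans (sym xs[p]≡a) xs[p]≡b)

  position-unique : ∀ {xs : List A} → Unique xs → ∀ {p q a} → xs [ p ]≡ a → xs [ q ]≡ a → p ≡ q
  position-unique {x ∷ xs} _          {zero}  {zero}  _    _    = refl
  position-unique {x ∷ xs} (x∉ ∷ _)   {zero}  {suc q} refl xs[q] = ⊥-elim (All.lookup x∉ (entry-∈ {xs} xs[q]) refl)
  position-unique {x ∷ xs} (x∉ ∷ _)   {suc p} {zero}  xs[p] refl = ⊥-elim (All.lookup x∉ (entry-∈ {xs} xs[p]) refl)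
  position-unique {x ∷ xs} (_ ∷ uxs) {suc p} {suc q} xs[p] xs[q] = cong suc (position-unique {xs} uxs xs[p] xs[q])

  block-entries : ∀ {P pre post block : List A} → P ≡ pre ++ block ++ post →
    ∀ {t b} → block [ t ]≡ b → P [ length pre + t ]≡ b
  block-entries {pre = pre} {post} {block} refl {t} block[t] =
    trans (nth-++ʳ pre (block ++ post) t) (trans (nth-++ˡ block post (entry-< {block} block[t])) block[t])

applyUpTo-entry : {A : Set} (f : ℕ → A) {L t : ℕ} → t < L → applyUpTo f L [ t ]≡ f t
applyUpTo-entry f {suc L} {zero}  _         = refl
applyUpTo-entry f {suc L} {suc t} (s≤s t<L) = applyUpTo-entry (f ∘ suc) t<L

consec-positions : ∀ {P a b} → Consec P a b → ∃[ p ] (P [ p ]≡ a × P [ suc p ]≡ b)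
consec-positions {P} {a} {b} (xs , ys , P≡) = length xs ,
  subst (P [_]≡ a) (+-identityʳ (length xs)) (block-entries {block = a ∷ b ∷ []} P≡ {0} refl) ,
  subst (P [_]≡ b) (+-comm (length xs) 1) (block-entries {block = a ∷ b ∷ []} P≡ {1} refl)

-- Close r c q e : |c − q| + e ≤ r, stated without truncated subtraction.
Close : ℕ → ℕ → ℕ → ℕ → Set
Close r c q e = (e + q ≤ c + r) × (e + c ≤ q + r)

close-mono : ∀ {r r′ c q e} → r ≤ r′ → Close r c q e → Close r′ c q e
close-mono {c = c} {q} r≤r′ (q≤ , c≤) = ≤-trans q≤ (+-monoʳ-≤ c r≤r′) , ≤-trans c≤ (+-monoʳ-≤ q r≤r′)

-- one more step of the walk lets the centre move by one position
close-shiftˡ : ∀ {r c q e} → Close r (suc c) q e → Close (suc r) c q e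
close-shiftˡ {r} {c} {q} {e} (q≤ , c≤) =
  ≤-trans q≤ (≤-reflexive (sym (+-suc c r))) ,
  ≤-trans (+-monoʳ-≤ e (n≤1+n c)) (≤-trans c≤ (+-monoʳ-≤ q (n≤1+n r)))

close-shiftʳ : ∀ {r c q e} → Close r c q e → Close (suc r) (suc c) q e
close-shiftʳ {r} {c} {q} {e} (q≤ , c≤) =
  ≤-trans q≤ (≤-trans (+-monoʳ-≤ c (n≤1+n r)) (n≤1+n _)) ,
  ≤-trans (≤-reflexive (+-suc e c)) (≤-trans (s≤s c≤) (≤-reflexive (sym (+-suc q r))))

ball : ℕ → ℕ → ℕ × ℕ
ball c r = c ∸ r , suc (c + r)

_∈ball_ : ℕ → ℕ × ℕ → Set
q ∈ball interval = q ∈[ proj₁ interval , proj₂ interval ⟩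

width : ℕ × ℕ → ℕ
width interval = proj₂ interval ∸ proj₁ interval

ball-width : ∀ c r → suc (c + r) ∸ (c ∸ r) ≤ 2 * r + 1
ball-width c r = m≤n+o⇒m∸n≤o (suc (c + r)) (c ∸ r) (begin
  suc (c + r)             ≤⟨ s≤s (+-monoˡ-≤ r (m≤n+m∸n c r)) ⟩
  suc (r + (c ∸ r) + r)   ≡⟨ regroup (c ∸ r) r ⟩
  c ∸ r + (2 * r + 1)     ∎)
  where
  open ≤-Reasoning
  regroup : ∀ d r → suc (r + d + r) ≡ d + (2 * r + 1)
  regroup = solve-∀

close⇒∈ball : ∀ {r c q} → Close r c q 0 → q ∈ball ball c r
close⇒∈ball {r} {c} {q} (q≤ , c≤) = m≤n+o⇒m∸n≤o c r (≤-trans c≤ (≤-reflexive (+-comm q r))) , s≤s q≤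

close-next : ∀ {r c q} → Close r c q 1 → Close r c (suc q) 0
close-next {r} {c} {q} (q<c+r , c<q+r) = q<c+r , ≤-trans (n≤1+n c) (≤-trans c<q+r (n≤1+n _))

close-weaken : ∀ {r c q} → Close r c q 1 → Close r c q 0
close-weaken (q<c+r , c<q+r) = ≤-trans (n≤1+n _) q<c+r , ≤-trans (n≤1+n _) c<q+r

s+r+r≡s+2r : ∀ s r → s + r + r ≡ s + 2 * r
s+r+r≡s+2r = solve-∀

reach-radius : ∀ {c s r r′} → c ≤ s + r′ → s + 2 * r ≤ c + r′ → r ≤ r′
reach-radius {c} {s} {r} {r′} c≤ s+2r≤ = *-cancelˡ-≤ 2 (+-cancelˡ-≤ s _ _ (begin
  s + 2 * r        ≤⟨ s+2r≤ ⟩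
  c + r′           ≤⟨ +-monoˡ-≤ r′ c≤ ⟩
  s + r′ + r′      ≡⟨ s+r+r≡s+2r s r′ ⟩
  s + 2 * r′       ∎))
  where
  open ≤-Reasoning

reach-middle : ∀ {c s r} → c ≤ s + r → s + 2 * r ≤ c + r → c ≡ s + r
reach-middle {c} {s} {r} c≤ s+2r≤ = ≤-antisym c≤ (+-cancelʳ-≤ r (s + r) c (begin
  s + r + r   ≡⟨ s+r+r≡s+2r s r ⟩
  s + 2 * r   ≤⟨ s+2r≤ ⟩
  c + r       ∎))
  where
  open ≤-Reasoning

reach-offset : ∀ {s s′ R} → s′ + R ≤ s + R → s ≤ s′ + R + R → s′ + (s ∸ s′) ≡ s × s ∸ s′ < 2 * R + 1
reach-offset {s} {s′} {R} s′+R≤ s≤ = m+[n∸m]≡n s′≤s ,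
  ≤-trans (s≤s (m≤n+o⇒m∸n≤o s s′ (≤-trans s≤ (≤-reflexive (s+r+r≡s+2r s′ R))))) (≤-reflexive (+-comm 1 (2 * R)))
  where
  s′≤s = +-cancelʳ-≤ R s′ s s′+R≤

r<2r+1 : ∀ r → r < 2 * r + 1
r<2r+1 r = ≤-trans (m≤m+n (suc r) (r + 0)) (≤-reflexive (+-comm 1 (2 * r)))

radius-antitone : ∀ K a b → b < K → K ∸ suc a ≤ K ∸ suc b → b ≤ a
radius-antitone K a b b<K radius≤ = ≮⇒≥ λ a<b → <⇒≱ (∸-monoʳ-< (s≤s a<b) b<K) radius≤

inner<2r+3 : ∀ {r t} → t ≤ suc (2 * r) → suc t < 2 * suc r + 1
inner<2r+3 {r} t≤ = ≤-trans (s≤s (s≤s t≤)) (≤-reflexive (3+2r≡ r))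
  where
  3+2r≡ : ∀ r → suc (suc (suc (2 * r))) ≡ 2 * suc r + 1
  3+2r≡ = solve-∀

+-suc-comm : ∀ s t → s + suc t ≡ t + suc s
+-suc-comm s t = trans (+-comm s (suc t)) (sym (+-suc t s))

block-end : ∀ s r → s + 2 * suc r ≡ suc (2 * r + suc s)
block-end = solve-∀

module Distances (n B : ℕ) (X : List ℕ) where
  private
    P = PI n B X
    G = IG n B X

  data Loc : Vtx → ℕ → ℕ → Set where
    on-path : ∀ {a q} → P [ q ]≡ a → Loc (pv a) q 0
    pendant : ∀ {a q} → P [ q ]≡ a → Loc (pd a) q 1

  -- A walk of length r from the path vertex at position c reaches only vertices
  -- at distance at most r: the position changes by one per path edge, and a
  -- pendant vertex costs one extra step.
  walk-from-path : Unique P → ∀ {r a c z q e} →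
    Within G r (pv a) z → P [ c ]≡ a → Loc z q e → Close r c q e
  walk-from-path uP here P[c] (on-path P[q]) with position-unique uP P[c] P[q]
  ... | refl = m≤m+n _ _ , m≤m+n _ _
  walk-from-path uP (step (path→ a-b) w) P[c] z-at with consec-positions a-b
  ... | p , P[p] , P[p+1] with position-unique uP P[c] P[p]
  ... | refl = close-shiftˡ (walk-from-path uP w P[p+1] z-at)
  walk-from-path uP (step (path← b-a) w) P[c] z-at with consec-positions b-a
  ... | p , P[p] , P[p+1] with position-unique uP P[c] P[p+1]
  ... | refl = close-shiftʳ (walk-from-path uP w P[p] z-at)
  walk-from-path uP {c = c} (step (pend→ _ _) here) P[c] (pendant P[q]) with position-unique uP P[c] P[q]
  ... | refl = c<c+1+r , c<c+1+r
    where
    c<c+1+r : ∀ {r} → suc c ≤ c + suc r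
    c<c+1+r {r} = ≤-trans (s≤s (m≤m+n c r)) (≤-reflexive (sym (+-suc c r)))
  walk-from-path uP (step (pend→ _ _) (step (pend← _ _) w)) P[c] z-at =
    close-mono (≤-trans (n≤1+n _) (n≤1+n _)) (walk-from-path uP w P[c] z-at)

module _ {A : Set} where

  ∈-interleaveʳ : ∀ {t : A} qs ts → t ∈ ts → t ∈ interleave qs ts
  ∈-interleaveʳ (q ∷ qs) (t ∷ ts) (here t≡)  = there (here t≡)
  ∈-interleaveʳ (q ∷ qs) (t ∷ ts) (there t∈) = there (there (∈-interleaveʳ qs ts t∈))
  ∈-interleaveʳ []       ts       t∈         = t∈

  All-interleave : ∀ {P : A → Set} qs ts → All P qs → All P ts → All P (interleave qs ts)
  All-interleave (q ∷ qs) (t ∷ ts) (pq ∷ pqs) (pt ∷ pts) = pq ∷ pt ∷ All-interleave qs ts pqs pts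
  All-interleave []       ts       _          pts        = pts
  All-interleave (q ∷ qs) []       pqs        _          = pqs

  AllPairs-interleave : ∀ {R : A → A → Set} → (∀ {x y} → R x y → R y x) → ∀ qs ts →
    AllPairs R qs → AllPairs R ts → All (λ q → All (R q) ts) qs → AllPairs R (interleave qs ts)
  AllPairs-interleave sym-R (q ∷ qs) (t ∷ ts) (Rq ∷ Rqs) (Rt ∷ Rts) (Rqts ∷ Rqsts) =
    (All.head Rqts ∷ All-interleave qs ts Rq (All.tail Rqts)) ∷
    All-interleave qs ts (All.map (sym-R ∘ All.head) Rqsts) Rt ∷
    AllPairs-interleave sym-R qs ts Rqs Rts (All.map All.tail Rqsts)
  AllPairs-interleave sym-R []       ts       _ Rts _ = Rts
  AllPairs-interleave sym-R (q ∷ qs) []       Rqs _ _ = Rqs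

block-unique : ∀ (f : ℕ → Lab) ℓ → (∀ {t t′} → f t ≡ f t′ → t ≡ t′) → Unique (applyUpTo f ℓ)
block-unique f ℓ f-inj = Uniqueₚ.applyUpTo⁺₁ f ℓ (λ t<t′ _ → <⇒≢ t<t′ ∘ f-inj)

blocks-disjoint : ∀ (f : ℕ → ℕ → Lab) → (∀ {c c′ t t′} → f c t ≡ f c′ t′ → c ≡ c′) →
  ∀ {c c′} ℓ ℓ′ → c ≢ c′ → Disjoint (applyUpTo (f c) ℓ) (applyUpTo (f c′) ℓ′)
blocks-disjoint f f-comp {c} {c′} ℓ ℓ′ c≢c′ (x∈ , x∈′)
  with ∈ₚ.∈-applyUpTo⁻ (f c) x∈ | ∈ₚ.∈-applyUpTo⁻ (f c′) x∈′
... | _ , _ , refl | _ , _ , fct≡fc′t′ = c≢c′ (f-comp fct≡fc′t′)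

IsT : Lab → Set
IsT (qv _ _) = ⊥
IsT (tv _ _) = ⊤

qv-injective : ∀ {c c′ t t′} → qv c t ≡ qv c′ t′ → c ≡ c′ × t ≡ t′
qv-injective refl = refl , refl

tv-injective : ∀ {j j′ t t′} → tv j t ≡ tv j′ t′ → j ≡ j′ × t ≡ t′
tv-injective refl = refl , refl

module QBlocks where
  qblock : ℕ → ℕ → List Lab
  qblock c ℓ = applyUpTo (qv c) ℓ

  unique : ∀ cs ls → All Unique (zipWith qblock cs ls)
  unique []       _        = []
  unique (c ∷ cs) []       = []
  unique (c ∷ cs) (ℓ ∷ ls) = block-unique (qv c) ℓ (proj₂ ∘ qv-injective) ∷ unique cs ls

  not-T : ∀ cs ls → All (All (¬_ ∘ IsT)) (zipWith qblock cs ls)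
  not-T []       _        = []
  not-T (c ∷ cs) []       = []
  not-T (c ∷ cs) (ℓ ∷ ls) = Allₚ.applyUpTo⁺₂ (qv c) ℓ (λ _ ()) ∷ not-T cs ls

  disjoint : ∀ cs ls → Unique cs → AllPairs Disjoint (zipWith qblock cs ls)
  disjoint []       _        _          = []
  disjoint (c ∷ cs) []       _          = []
  disjoint (c ∷ cs) (ℓ ∷ ls) (c∉ ∷ ucs) = from-c cs ls c∉ ∷ disjoint cs ls ucs
    where
    from-c : ∀ cs ls → All (c ≢_) cs → All (Disjoint (qblock c ℓ)) (zipWith qblock cs ls)
    from-c []        _         _            = []
    from-c (c′ ∷ cs) []        _            = []
    from-c (c′ ∷ cs) (ℓ′ ∷ ls) (c≢c′ ∷ c∉) =
      blocks-disjoint qv (proj₁ ∘ qv-injective) ℓ ℓ′ c≢c′ ∷ from-c cs ls c∉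

module TBlocks (m : ℕ) where
  tblock : ℕ → List Lab
  tblock i = applyUpTo (tv (suc i)) (lenT m (suc i))

  unique : All Unique (Tblocks m)
  unique = Allₚ.applyUpTo⁺₂ tblock (suc m) (λ i → block-unique (tv (suc i)) _ (proj₂ ∘ tv-injective))

  is-T : All (All IsT) (Tblocks m)
  is-T = Allₚ.applyUpTo⁺₂ tblock (suc m) (λ i → Allₚ.applyUpTo⁺₂ (tv (suc i)) _ (λ _ → tt))

  disjoint : AllPairs Disjoint (Tblocks m)
  disjoint = AllPairsₚ.applyUpTo⁺₁ tblock (suc m) λ i<j _ →
    blocks-disjoint (λ i → tv (suc i)) (suc-injective ∘ proj₁ ∘ tv-injective) _ _ (<⇒≢ i<j)

PI-unique : ∀ n B X → Unique (PI n B X)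
PI-unique n B X = Uniqueₚ.concat⁺
  (All-interleave Qs Ts (QBlocks.unique cs ls) (TBlocks.unique m))
  (AllPairs-interleave Disjointₚ.sym Qs Ts (QBlocks.disjoint cs ls (Uniqueₚ.upTo⁺ _))
    (TBlocks.disjoint m)
    (All.map (λ notT → All.map (Q-T-disjoint notT) (TBlocks.is-T m)) (QBlocks.not-T cs ls)))
  where
  m = maxL X
  ls = Qlens n B X
  cs = upTo (length ls)
  Qs = Qblocks n B X
  Ts = Tblocks m
  Q-T-disjoint : ∀ {q t} → All (¬_ ∘ IsT) q → All IsT t → Disjoint q t
  Q-T-disjoint notT isT (x∈q , x∈t) = All.lookup notT x∈q (All.lookup isT x∈t)

T-occurs : ∀ n B X i → i ≤ maxL X → ∃[ pre ] ∃[ post ]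
  PI n B X ≡ pre ++ TBlocks.tblock (maxL X) i ++ post
T-occurs n B X i i≤m
  with ∈ₚ.∈-∃++ (∈-interleaveʳ (Qblocks n B X) _ (∈ₚ.∈-applyUpTo⁺ (TBlocks.tblock (maxL X)) (s≤s i≤m)))
... | xss , yss , blocks≡ = concat xss , concat yss ,
  trans (cong concat blocks≡) (sym (Listₚ.concat-++ xss (_ ∷ yss)))

∑-as-list : ∀ K (h : ℕ → ℕ) → ∑[ i < K ] h (toℕ i) ≡ sum (applyUpTo h K)
∑-as-list zero    h = refl
∑-as-list (suc K) h = cong (h 0 +_) (∑-as-list K (h ∘ suc))

applyUpTo-+ : ∀ {A : Set} (h : ℕ → A) a b → applyUpTo h (a + b) ≡ applyUpTo h a ++ applyUpTo (h ∘ (a +_)) b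
applyUpTo-+ h zero    b = refl
applyUpTo-+ h (suc a) b = cong (h 0 ∷_) (applyUpTo-+ (h ∘ suc) a b)

sum-applyUpTo-cong : ∀ (f g : ℕ → ℕ) n → (∀ i → f i ≡ g i) → sum (applyUpTo f n) ≡ sum (applyUpTo g n)
sum-applyUpTo-cong f g zero    f≗g = refl
sum-applyUpTo-cong f g (suc n) f≗g = cong₂ _+_ (f≗g 0) (sum-applyUpTo-cong (f ∘ suc) (g ∘ suc) n (f≗g ∘ suc))

applyUpTo-reverse : ∀ (g : ℕ → ℕ) m → applyUpTo (λ i → g (m ∸ suc i)) m ≡ applyDownFrom g m
applyUpTo-reverse g zero    = refl
applyUpTo-reverse g (suc m) = cong (g m ∷_) (applyUpTo-reverse g m)

ball-size : ℕ → ℕ → ℕ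
ball-size m i = 2 * (2 * m + 1 ∸ suc i) + 1

-- The balls of radii 2m, …, 0 have sizes 4m+1, …, 1: the first m+1 of them are the
-- lengths of T_1, …, T_{m+1}, the remaining m are the odd numbers F′_m.
ball-sizes-split : ∀ m →
  sum (applyUpTo (ball-size m) (2 * m + 1)) ≡ sum (map length (Tblocks m)) + sum (oddsDesc m)
ball-sizes-split m = begin
  sum (applyUpTo h (2 * m + 1))                              ≡⟨ cong (sum ∘ applyUpTo h) (2m+1≡ m) ⟩
  sum (applyUpTo h (suc m + m))                              ≡⟨ cong sum (applyUpTo-+ h (suc m) m) ⟩
  sum (applyUpTo h (suc m) ++ applyUpTo (h ∘ (suc m +_)) m)  ≡⟨ Sumₚ.sum-++ (applyUpTo h (suc m)) _ ⟩
  sum (applyUpTo h (suc m)) + sum (applyUpTo (h ∘ (suc m +_)) m)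
    ≡⟨ cong₂ _+_ (sym T-lengths) (sum-applyUpTo-cong _ _ m tail-odd) ⟩
  sum (map length (Tblocks m)) + sum (applyUpTo (λ i → 2 * (m ∸ suc i) + 1) m)
    ≡⟨ cong (λ xs → sum (map length (Tblocks m)) + sum xs) (applyUpTo-reverse (λ j → 2 * j + 1) m) ⟩
  sum (map length (Tblocks m)) + sum (oddsDesc m)            ∎
  where
  open ≡-Reasoning
  h = ball-size m
  2m+1≡ : ∀ m → 2 * m + 1 ≡ suc m + m
  2m+1≡ = solve-∀
  T-lengths : sum (map length (Tblocks m)) ≡ sum (applyUpTo h (suc m))
  T-lengths = trans (cong sum (Listₚ.map-applyUpTo (TBlocks.tblock m) length (suc m)))
    (sum-applyUpTo-cong _ _ (suc m) (λ i → Listₚ.length-applyUpTo (tv (suc i)) (lenT m (suc i))))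
  tail-odd : ∀ i → h (suc m + i) ≡ 2 * (m ∸ suc i) + 1
  tail-odd i = cong (λ k → 2 * k + 1)
    (trans (cong₂ _∸_ (2m+1≡ m) (sym (+-suc (suc m) i))) ([m+n]∸[m+o]≡n∸o (suc m) m (suc i)))

x+[a+b]≡a+[x+b] : ∀ x a b → x + (a + b) ≡ a + (x + b)
x+[a+b]≡a+[x+b] = solve-∀

sum-filter-split : ∀ {P : ℕ → Set} (P? : Decidable P) xs →
  sum xs ≡ sum (filter P? xs) + sum (filter (¬? ∘ P?) xs)
sum-filter-split P? []       = refl
sum-filter-split P? (x ∷ xs) with P? x
... | yes _ = trans (cong (x +_) (sum-filter-split P? xs)) (sym (+-assoc x _ _))
... | no  _ = trans (cong (x +_) (sum-filter-split P? xs)) (x+[a+b]≡a+[x+b] x (sum (filter P? xs)) (sum (filter (¬? ∘ P?) xs)))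

sum-⊆ : ∀ xs ys → Unique xs → (∀ {x} → x ∈ xs → x ∈ ys) → sum xs ≤ sum ys
sum-⊆ []       ys _          _     = z≤n
sum-⊆ (x ∷ xs) ys (x∉ ∷ uxs) xs⊆ys with ∈ₚ.∈-∃++ (xs⊆ys (here refl))
... | as , bs , refl = begin
  x + sum xs             ≤⟨ +-monoʳ-≤ x (sum-⊆ xs (as ++ bs) uxs xs⊆as++bs) ⟩
  x + sum (as ++ bs)     ≡⟨ cong (x +_) (Sumₚ.sum-++ as bs) ⟩
  x + (sum as + sum bs)  ≡⟨ x+[a+b]≡a+[x+b] x (sum as) (sum bs) ⟩
  sum as + (x + sum bs)  ≡⟨ Sumₚ.sum-++ as (x ∷ bs) ⟨
  sum (as ++ x ∷ bs)     ∎
  where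
  open ≤-Reasoning
  xs⊆as++bs : ∀ {z} → z ∈ xs → z ∈ as ++ bs
  xs⊆as++bs z∈xs with ∈ₚ.∈-++⁻ as (xs⊆ys (there z∈xs))
  ... | inj₁ z∈as         = ∈ₚ.∈-++⁺ˡ z∈as
  ... | inj₂ (here refl)  = ⊥-elim (All.lookup x∉ z∈xs refl)
  ... | inj₂ (there z∈bs) = ∈ₚ.∈-++⁺ʳ as z∈bs

-- F′_m splits into Y and F′_m ∩ X′, so its sum is at most ∑ Y + ∑ X′.
odds-bound : ∀ X → sum (oddsDesc (maxL X)) ≤ sum (Ylist X) + sum (X′ X)
odds-bound X = begin
  sum odds                                         ≡⟨ sum-filter-split ∈X′? odds ⟩
  sum (filter ∈X′? odds) + sum (Ylist X)          ≤⟨ +-monoˡ-≤ (sum (Ylist X)) (sum-⊆ _ _ unique-part ⊆X′) ⟩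
  sum (X′ X) + sum (Ylist X)                       ≡⟨ +-comm (sum (X′ X)) _ ⟩
  sum (Ylist X) + sum (X′ X)                       ∎
  where
  open ≤-Reasoning
  odds = oddsDesc (maxL X)
  ∈X′? = λ y → y ∈? X′ X
  odds-unique : Unique odds
  odds-unique = Uniqueₚ.applyDownFrom⁺₁ (λ j → 2 * j + 1) (maxL X)
    (λ j<i _ odd≡ → <⇒≢ j<i (sym (*-cancelˡ-≡ _ _ 2 (+-cancelʳ-≡ 1 _ _ odd≡))))
  unique-part : Unique (filter ∈X′? odds)
  unique-part = Uniqueₚ.filter⁺ ∈X′? odds-unique
  ⊆X′ : ∀ {y} → y ∈ filter ∈X′? odds → y ∈ X′ X
  ⊆X′ = proj₂ ∘ ∈ₚ.∈-filter⁻ ∈X′? {xs = odds}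

-- Since a ≥ 1, replacing each a by 2a − 1 turns ∑ X into 2 ∑ X − |X|.
sum-X′ : ∀ X → All (1 ≤_) X → sum (X′ X) + length X ≡ 2 * sum X
sum-X′ []      _          = refl
sum-X′ (a ∷ X) (1≤a ∷ 1≤X) = begin
  (2 * a ∸ 1 + sum (X′ X)) + suc (length X)   ≡⟨ regroup (2 * a ∸ 1) (sum (X′ X)) (length X) ⟩
  (2 * a ∸ 1 + 1) + (sum (X′ X) + length X)   ≡⟨ cong₂ _+_ (m∸n+n≡m (≤-trans 1≤a (m≤m+n a _))) (sum-X′ X 1≤X) ⟩
  2 * a + 2 * sum X                           ≡⟨ *-distribˡ-+ 2 a (sum X) ⟨
  2 * (a + sum X)                             ∎
  where
  open ≡-Reasoning
  regroup : ∀ p q r → (p + q) + suc r ≡ (p + 1) + (q + r)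
  regroup = solve-∀

Q-total : ∀ n B X → length X ≡ 3 * n → sum X ≡ n * B → All (1 ≤_) X → n * (2 * B ∸ 3) ≡ sum (X′ X)
Q-total n B X |X|≡3n ∑X≡nB 1≤X = begin
  n * (2 * B ∸ 3)                    ≡⟨ *-distribˡ-∸ n (2 * B) 3 ⟩
  n * (2 * B) ∸ n * 3                ≡⟨ cong₂ _∸_ 2nB≡ (trans (*-comm n 3) (sym |X|≡3n)) ⟩
  sum (X′ X) + length X ∸ length X   ≡⟨ m+n∸n≡m (sum (X′ X)) (length X) ⟩
  sum (X′ X)                         ∎
  where
  open ≡-Reasoning
  n*[2*B]≡2*[n*B] : ∀ n B → n * (2 * B) ≡ 2 * (n * B)
  n*[2*B]≡2*[n*B] = solve-∀
  2nB≡ : n * (2 * B) ≡ sum (X′ X) + length X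
  2nB≡ = trans (n*[2*B]≡2*[n*B] n B) (trans (cong (2 *_) (sym ∑X≡nB)) (sym (sum-X′ X 1≤X)))

sum-interleave : ∀ (qs ts : List (List Lab)) →
  sum (map length (interleave qs ts)) ≡ sum (map length qs) + sum (map length ts)
sum-interleave (q ∷ qs) (t ∷ ts) = trans (cong (λ k → length q + (length t + k)) (sum-interleave qs ts))
  (regroup (length q) (length t) _ _)
  where
  regroup : ∀ a b c d → a + (b + (c + d)) ≡ (a + c) + (b + d)
  regroup = solve-∀
sum-interleave []       ts = refl
sum-interleave (q ∷ qs) [] = sym (+-identityʳ _)

length-concat : ∀ (bss : List (List Lab)) → length (concat bss) ≡ sum (map length bss)
length-concat []         = refl
length-concat (bs ∷ bss) = trans (Listₚ.length-++ bs) (cong (length bs +_) (length-concat bss))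

Qblocks-lengths : ∀ cs ls → length ls ≤ length cs → map length (zipWith QBlocks.qblock cs ls) ≡ ls
Qblocks-lengths []       []       _         = refl
Qblocks-lengths (c ∷ cs) []       _         = refl
Qblocks-lengths (c ∷ cs) (ℓ ∷ ls) (s≤s ≤cs) = cong₂ _∷_ (Listₚ.length-applyUpTo (qv c) ℓ) (Qblocks-lengths cs ls ≤cs)

length-PI : ∀ n B X →
  length (PI n B X) ≡ (n * (2 * B ∸ 3) + sum (Ylist X)) + sum (map length (Tblocks (maxL X)))
length-PI n B X = begin
  length (PI n B X)                                     ≡⟨ length-concat (interleave Qs Ts) ⟩
  sum (map length (interleave Qs Ts))                   ≡⟨ sum-interleave Qs Ts ⟩
  sum (map length Qs) + sum (map length Ts)             ≡⟨ cong (λ xs → sum xs + sum (map length Ts)) Q-lengths ⟩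
  sum (Qlens n B X) + sum (map length Ts)               ≡⟨ cong (_+ sum (map length Ts)) ∑Qlens ⟩
  (n * (2 * B ∸ 3) + sum (Ylist X)) + sum (map length Ts) ∎
  where
  open ≡-Reasoning
  Qs = Qblocks n B X
  Ts = Tblocks (maxL X)
  Q-lengths : map length Qs ≡ Qlens n B X
  Q-lengths = Qblocks-lengths _ (Qlens n B X) (≤-reflexive (sym (Listₚ.length-upTo _)))
  sum-replicate : ∀ k c → sum (replicate k c) ≡ k * c
  sum-replicate zero    c = refl
  sum-replicate (suc k) c = cong (c +_) (sum-replicate k c)
  ∑Qlens : sum (Qlens n B X) ≡ n * (2 * B ∸ 3) + sum (Ylist X)
  ∑Qlens = trans (Sumₚ.sum-++ (replicate n (2 * B ∸ 3)) (Ylist X))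
    (cong (_+ sum (Ylist X)) (sum-replicate n (2 * B ∸ 3)))

balls-fit : ∀ n B X → length X ≡ 3 * n → sum X ≡ n * B → All (1 ≤_) X →
  ∑[ i < 2 * maxL X + 1 ] ball-size (maxL X) (toℕ i) ≤ length (PI n B X)
balls-fit n B X |X|≡3n ∑X≡nB 1≤X = begin
  ∑[ i < 2 * m + 1 ] ball-size m (toℕ i)                  ≡⟨ ∑-as-list (2 * m + 1) (ball-size m) ⟩
  sum (applyUpTo (ball-size m) (2 * m + 1))               ≡⟨ ball-sizes-split m ⟩
  sum (map length Ts) + sum (oddsDesc m)                  ≤⟨ +-monoʳ-≤ (sum (map length Ts)) (odds-bound X) ⟩
  sum (map length Ts) + (sum (Ylist X) + sum (X′ X))      ≡⟨ cong (λ k → sum (map length Ts) + (sum (Ylist X) + k))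
                                                               (Q-total n B X |X|≡3n ∑X≡nB 1≤X) ⟨
  sum (map length Ts) + (sum (Ylist X) + n * (2 * B ∸ 3)) ≡⟨ regroup (sum (map length Ts)) (sum (Ylist X)) _ ⟩
  (n * (2 * B ∸ 3) + sum (Ylist X)) + sum (map length Ts) ≡⟨ length-PI n B X ⟨
  length (PI n B X)                                       ∎
  where
  open ≤-Reasoning
  m = maxL X
  Ts = Tblocks m
  regroup : ∀ a b c → a + (b + c) ≡ (c + b) + a
  regroup = solve-∀

-- The analysis of a burning sequence y of length 2m + 1 of IG(X), under the
-- hypotheses of lemma5 (of which the volume bound needs only a ≥ 1 for a ∈ X).
module Burning (n B : ℕ) (X : List ℕ)
  (|X|≡3n : length X ≡ 3 * n) (∑X≡nB : sum X ≡ n * B) (1≤X : All (1 ≤_) X)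
  (y : Fin (2 * maxL X + 1) → Vtx) (burning : IsBurningSeq (IG n B X) (2 * maxL X + 1) y) where

  open Distances n B X

  private
    m = maxL X
    K = 2 * m + 1
    P = PI n B X
    G = IG n B X
    N = length P
    uP = PI-unique n B X

  rad : Fin K → ℕ
  rad i = K ∸ suc (toℕ i)

  source-vertex : ∀ i → Graph.vert G (y i)
  source-vertex = proj₁ burning

  anchor : ∀ v → Graph.vert G v → ℕ
  anchor (pv a) a∈P       = proj₁ (∈-entry a∈P)
  anchor (pd a) (a∈P , _) = proj₁ (∈-entry a∈P)

  anchor-entry : ∀ v hv {a} → v ≡ pv a → P [ anchor v hv ]≡ a
  anchor-entry (pv a) a∈P refl = proj₂ (∈-entry a∈P)

  -- A pendant source spends one round
  -- reaching the path, and with no round left it burns no path vertex at all.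
  footprint : ∀ v → Graph.vert G v → ℕ → ℕ × ℕ
  footprint (pv a) hv r       = ball (anchor (pv a) hv) r
  footprint (pd a) hv zero    = 0 , 0
  footprint (pd a) hv (suc r) = ball (anchor (pd a) hv) r

  footprint-width : ∀ v hv r → width (footprint v hv r) ≤ 2 * r + 1
  footprint-width (pv a) hv r       = ball-width _ r
  footprint-width (pd a) hv zero    = z≤n
  footprint-width (pd a) hv (suc r) = ≤-trans (ball-width _ r) (+-monoˡ-≤ 1 (*-monoʳ-≤ 2 (n≤1+n r)))

  wide⇒path-vertex : ∀ v hv r → 2 * r + 1 ≤ width (footprint v hv r) → ∃[ a ] v ≡ pv a
  wide⇒path-vertex (pv a) _  _       _    = a , refl
  wide⇒path-vertex (pd a) hv (suc r) wide =
    ⊥-elim (<⇒≱ (+-monoˡ-< 1 (*-monoʳ-< 2 (n<1+n r))) (≤-trans wide (ball-width _ r)))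

  footprint-covers : ∀ v hv r {b q} → Within G r v (pv b) → P [ q ]≡ b → q ∈ball footprint v hv r
  footprint-covers (pv a) a∈P r w P[q] =
    close⇒∈ball (walk-from-path uP w (proj₂ (∈-entry a∈P)) (on-path P[q]))
  footprint-covers (pd a) (a∈P , _) (suc r) (step (pend← _ _) w) P[q] =
    close⇒∈ball (walk-from-path uP w (proj₂ (∈-entry a∈P)) (on-path P[q]))

  close⇒in-footprint : ∀ v hv {r q} → ∃[ a ] v ≡ pv a → Close r (anchor v hv) q 0 → q ∈ball footprint v hv r
  close⇒in-footprint (pv a) hv _ close = close⇒∈ball close

  -- The footprints of the 2m+1 sources cover P_I and have total width at most |P_I|,
  -- so by the tight cover lemma they all have full width and do not overlap.
  private
    lo hi : Fin K → ℕ
    lo i = proj₁ (footprint (y i) (source-vertex i) (rad i))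
    hi i = proj₂ (footprint (y i) (source-vertex i) (rad i))

  tight : (∀ i → 2 * rad i + 1 ≤ hi i ∸ lo i) ×
          (∀ q → q < N → ∀ {i j} → q ∈[ lo i , hi i ⟩ → q ∈[ lo j , hi j ⟩ → i ≡ j)
  tight = tight-cover N lo hi (λ i → 2 * rad i + 1)
    (λ i → footprint-width (y i) (source-vertex i) (rad i))
    (balls-fit n B X |X|≡3n ∑X≡nB 1≤X)
    cover
    where
    cover : ∀ q → q < N → ∃[ i ] q ∈[ lo i , hi i ⟩
    cover q q<N =
      let b , P[q] = <-entry P q<N
          i , w    = proj₂ burning (pv b) (entry-∈ {xs = P} P[q])
      in  i , footprint-covers (y i) (source-vertex i) (rad i) w P[q]

  sources-on-path : ∀ i → ∃[ a ] y i ≡ pv a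
  sources-on-path i = wide⇒path-vertex (y i) (source-vertex i) (rad i) (proj₁ tight i)

  centre : Fin K → ℕ
  centre i = anchor (y i) (source-vertex i)

  centre-entry : ∀ i {a} → y i ≡ pv a → P [ centre i ]≡ a
  centre-entry i = anchor-entry (y i) (source-vertex i)

  reach : ∀ i {z q e} → Within G (rad i) (y i) z → Loc z q e → Close (rad i) (centre i) q e
  reach i w z-at = walk-from-path uP (subst (λ v → Within G (rad i) v _) y≡ w) (centre-entry i y≡) z-at
    where
    y≡ = proj₂ (sources-on-path i)

  exclusive : ∀ {q i j} → q < N → Close (rad i) (centre i) q 0 → Close (rad j) (centre j) q 0 → i ≡ j
  exclusive {q} {i} {j} q<N ci cj = proj₂ tight q q<N
    (close⇒in-footprint (y i) (source-vertex i) (sources-on-path i) ci)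
    (close⇒in-footprint (y j) (source-vertex j) (sources-on-path j) cj)

  covered : ∀ {q b} → P [ q ]≡ b → ∃[ i ] Close (rad i) (centre i) q 0
  covered P[q] =
    let i , w = proj₂ burning (pv _) (entry-∈ {xs = P} P[q]) in i , reach i w (on-path P[q])

  covered-strictly : ∀ {q b} → P [ q ]≡ b → InternalT m b → ∃[ i ] Close (rad i) (centre i) q 1
  covered-strictly P[q] internal =
    let i , w = proj₂ burning (pd _) (entry-∈ {xs = P} P[q] , internal) in i , reach i w (pendant P[q])

  TBlockAt : ℕ → ℕ → ℕ → Set
  TBlockAt j s r = ∀ t → t < 2 * r + 1 → P [ s + t ]≡ tv j t

  T-at : ∀ i → toℕ i ≤ m → ∃[ s ] TBlockAt (suc (toℕ i)) s (rad i)
  T-at i i≤m =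
    let pre , post , P≡ = T-occurs n B X (toℕ i) i≤m
    in  length pre , λ t t<len → block-entries {pre = pre} {post} P≡ (applyUpTo-entry (tv (suc (toℕ i))) t<len)

  -- Each of them is strictly covered by
  -- some source, which then also reaches the previous one; by exclusivity it is the same.
  sweep : ∀ i p L → (∀ t → t ≤ L → ∃[ b ] (P [ t + p ]≡ b × InternalT m b)) →
    Close (rad i) (centre i) p 1 → Close (rad i) (centre i) (L + p) 1
  sweep i p zero    _        start = start
  sweep i p (suc L) pendants start = continue (pendants (suc L) ≤-refl)
    where
    previous : Close (rad i) (centre i) (L + p) 1
    previous = sweep i p L (λ t t≤L → pendants t (m≤n⇒m≤1+n t≤L)) start
    continue : ∃[ b ] (P [ suc L + p ]≡ b × InternalT m b) → Close (rad i) (centre i) (suc L + p) 1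
    continue (b , P[q] , internal) = same-source (covered-strictly P[q] internal)
      where
      same-source : ∃[ j ] Close (rad j) (centre j) (suc L + p) 1 → Close (rad i) (centre i) (suc L + p) 1
      same-source (j , cj) = subst (λ k → Close (rad k) (centre k) (suc L + p) 1)
        (exclusive {suc L + p} {j} {i} (entry-< {xs = P} P[q]) (close-weaken cj) (close-next previous)) cj

  -- Some source reaches both ends of a T-block of length 2r + 1: for r > 0 it is the
  -- source burning all its pendants, which it sweeps from end to end.
  block-reacher : ∀ j s r → lenT m j ≡ 2 * r + 1 → TBlockAt j s r →
    ∃[ k ] (centre k ≤ s + rad k × s + 2 * r ≤ centre k + rad k)
  block-reacher j s zero _ block = single (covered (block 0 (s≤s z≤n)))
    where
    single : ∃[ k ] Close (rad k) (centre k) (s + 0) 0 → ∃[ k ] (centre k ≤ s + rad k × s + 0 ≤ centre k + rad k)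
    single (k , (s≤ , c≤)) = k , subst (λ x → centre k ≤ x + rad k) (+-identityʳ s) c≤ , s≤
  block-reacher j s (suc r) len≡ block =
    from-first (covered-strictly (proj₁ (proj₂ (pendants 0 z≤n))) (proj₂ (proj₂ (pendants 0 z≤n))))
    where
    pendants : ∀ t → t ≤ 2 * r → ∃[ b ] (P [ t + suc s ]≡ b × InternalT m b)
    pendants t t≤2r = tv j (suc t) ,
      subst (P [_]≡ tv j (suc t)) (+-suc-comm s t) (block (suc t) (inner<2r+3 (m≤n⇒m≤1+n t≤2r))) ,
      s≤s z≤n , subst (suc (suc t) <_) (sym len≡) (inner<2r+3 (s≤s t≤2r))
    from-first : ∃[ k ] Close (rad k) (centre k) (suc s) 1 →
      ∃[ k ] (centre k ≤ s + rad k × s + 2 * suc r ≤ centre k + rad k)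
    from-first (k , start) = k , s≤s⁻¹ (proj₂ start) ,
      ≤-trans (≤-reflexive (block-end s r)) (proj₁ (sweep k (suc s) (2 * r) pendants start))

  Middle : Fin K → Set
  Middle i = y i ≡ pv (tv (suc (toℕ i)) (rad i))

  -- An earlier source sitting in the middle of its own T-block reaches no vertex
  -- outside that block, in particular not the first vertex of a later T-block.
  earlier-misses : ∀ i j s → TBlockAt (suc (toℕ i)) s (rad i) → toℕ j < toℕ i → toℕ j ≤ m → Middle j →
    centre j ≤ s + rad j → s ≤ centre j + rad j → ⊥
  earlier-misses i j s block j<i j≤m middle c≤ s≤ = <⇒≢ j<i (suc-injective (proj₁ (tv-injective same-label)))
    where
    R = rad j
    s′ = proj₁ (T-at j j≤m)
    block′ = proj₂ (T-at j j≤m)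
    c≡ : centre j ≡ s′ + R
    c≡ = position-unique uP (centre-entry j middle) (block′ R (r<2r+1 R))
    offset = reach-offset {s} {s′} {R} (subst (_≤ s + R) c≡ c≤) (subst (λ c → s ≤ c + R) c≡ s≤)
    same-label : tv (suc (toℕ j)) (s ∸ s′) ≡ tv (suc (toℕ i)) 0
    same-label = entry-functional {xs = P}
      (subst (P [_]≡ tv (suc (toℕ j)) (s ∸ s′)) (proj₁ offset) (block′ (s ∸ s′) (proj₂ offset)))
      (subst (P [_]≡ tv (suc (toℕ i)) 0) (+-identityʳ s) (block 0 (≤-trans (s≤s z≤n) (r<2r+1 (rad i)))))

  -- The
  -- source reaching both ends of T_{i+1} has radius ≥ rad i, so it is not a later one;
  -- it is not an earlier one by earlier-misses, hence it is the i-th, in the middle.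
  middle-step : ∀ i → (∀ {j} → toℕ j < toℕ i → toℕ j ≤ m → Middle j) → toℕ i ≤ m → Middle i
  middle-step i earlier i≤m = conclude (block-reacher (suc (toℕ i)) s (rad i) refl block)
    where
    s = proj₁ (T-at i i≤m)
    block = proj₂ (T-at i i≤m)
    conclude : ∃[ k ] (centre k ≤ s + rad k × s + 2 * rad i ≤ centre k + rad k) → Middle i
    conclude (k , c≤ , s+2r≤) = either (m≤n⇒m<n∨m≡n k≤i)
      where
      k≤i : toℕ k ≤ toℕ i
      k≤i = radius-antitone K (toℕ i) (toℕ k) (Finₚ.toℕ<n k) (reach-radius c≤ s+2r≤)
      either : toℕ k < toℕ i ⊎ toℕ k ≡ toℕ i → Middle i
      either (inj₁ k<i) = ⊥-elim (earlier-misses i k s block k<i (≤-trans (<⇒≤ k<i) i≤m)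
        (earlier k<i (≤-trans (<⇒≤ k<i) i≤m)) c≤ (≤-trans (m≤m+n s (2 * rad i)) s+2r≤))
      either (inj₂ toℕk≡toℕi) = subst Middle k≡i middle-k
        where
        k≡i = Finₚ.toℕ-injective toℕk≡toℕi
        k-block : TBlockAt (suc (toℕ k)) s (rad k)
        k-block = subst (λ x → TBlockAt (suc (toℕ x)) s (rad x)) (sym k≡i) block
        y≡ = proj₂ (sources-on-path k)
        middle-k : Middle k
        middle-k = trans y≡ (cong pv (entry-functional {xs = P} (centre-entry k y≡)
          (subst (P [_]≡ tv (suc (toℕ k)) (rad k)) (sym (reach-middle c≤ (subst (λ x → s + 2 * rad x ≤ centre k + rad k) (sym k≡i) s+2r≤)))
            (k-block (rad k) (r<2r+1 (rad k))))))

  middle : ∀ i → toℕ i ≤ m → Middle i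
  middle = WF.All.wfRec <-wellFounded 0ℓ (λ i → toℕ i ≤ m → Middle i) middle-step

lemma5 : (n B : ℕ) (X : List ℕ) →
    length X ≡ 3 * n → Unique X → sum X ≡ n * B →
    All (λ a → (B < 4 * a) × (2 * a < B)) X →
    (y : Fin (2 * maxL X + 1) → Vtx) →
    IsBurningSeq (IG n B X) (2 * maxL X + 1) y →
    (i : Fin (2 * maxL X + 1)) → toℕ i ≤ maxL X →
    y i ≡ pv (tv (suc (toℕ i)) (2 * maxL X ∸ toℕ i))
lemma5 n B X |X|≡3n _ ∑X≡nB bounds y burning i i≤m =
  trans (Burning.middle n B X |X|≡3n ∑X≡nB (All.map positive bounds) y burning i i≤m)
        (cong (λ k → pv (tv (suc (toℕ i)) (k ∸ suc (toℕ i)))) (+-comm (2 * maxL X) 1))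
  where
  -- B/4 < a forces a ≥ 1, which is all the volume bound needs
  positive : ∀ {a} → (B < 4 * a) × (2 * a < B) → 1 ≤ a
  positive {zero}  (B<0 , _) = ⊥-elim (n≮0 B<0)
  positive {suc a} _         = s≤s z≤n
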